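{- Let $(X,\{R_i\}_{i=0}^d)$ be an association scheme with adjacency matrices $A_0,\dots,A_d$, valencies $k_0,\dots,k_d$ and intersection numbers $p_{ij}^k$, and let $W,W'$ be type-II matrices in its Bose--Mesner algebra. Suppose that each of $W$ and $W'$ has exactly $d+1$ distinct entries, that the valencies $k_0,\dots,k_d$ are pairwise distinct, and that $\min\{p_{11}^i\mid 0<i\le d\}>\frac{|X|}{2}$. If $W$ and $W'$ are equivalent, then $W$ is a scalar multiple of $W'$.
   Context: An association scheme is a partition of $X\times X$ into relations $R_0=\{(x,x)\},R_1,\dots,R_d$ with each transpose $R_i^\top$ equal to some $R_{i'}$ and such that $p_{ij}^k=|\{z:(x,z)\in R_i,(z,y)\in R_j\}|$ depends only on $k$ for $(x,y)\in R_k$; its Bose--Mesner algebra is the span of the $(0,1)$-adjacency matrices $A_i$ of $R_i$, and the valency $k_i$ is the number of $y$ with $(x,y)\in R_i$. A type-II matrix of order $n$ is a square matrix $W$ with nonzero entries and $W(W^{(-)})^\top=nI$, $W^{(-)}$ the entrywise inverse. Two type-II matrices $W_1,W_2$ are equivalent if there exist diagonal matrices $D,D'$ with nonzero diagonal entries and permutation matrices $T,T'$ with $DW_1D'=TW_2T'$. -}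

module Defs where

open import Level using (_⊔_)
open import Data.Nat as ℕ using (ℕ; zero; suc)
open import Data.Bool using (Bool; true; false; if_then_else_; _∧_)
open import Data.Fin as Fin using (Fin)
open import Data.Fin.Permutation using (Permutation′; _⟨$⟩ʳ_)
open import Data.Product using (Σ; ∃; _×_; _,_)
open import Relation.Nullary using (¬_)
open import Relation.Nullary.Decidable using (⌊_⌋)
open import Relation.Binary.PropositionalEquality using (_≡_)
open import Algebra.Bundles using (CommutativeRing)

count : ∀ {n} → (Fin n → Bool) → ℕ
count {zero}  f = 0
count {suc n} f = (if f Fin.zero then 1 else 0) ℕ.+ count (λ z → f (Fin.suc z))

one : ∀ {d} → 1 ℕ.≤ d → Fin (suc d)
one 1≤d = Fin.fromℕ< (ℕ.s≤s 1≤d)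

-- An association scheme on X = Fin n with relations R_0,…,R_d,
-- given by the map rel : X × X → {0,…,d}, (x,y) ∈ R_(rel x y).
record AssocScheme (n d : ℕ) : Set where
  field
    rel      : Fin n → Fin n → Fin (suc d)
    rel0⇒eq  : ∀ x y → rel x y ≡ Fin.zero → x ≡ y
    eq⇒rel0  : ∀ x → rel x x ≡ Fin.zero
    nonempty : ∀ i → Σ (Fin n) λ x → Σ (Fin n) λ y → rel x y ≡ i
    tr       : Fin (suc d) → Fin (suc d)
    rel-tr   : ∀ x y → rel y x ≡ tr (rel x y)
    p        : Fin (suc d) → Fin (suc d) → Fin (suc d) → ℕ
    p-spec   : ∀ i j x y →
               count (λ z → ⌊ rel x z Fin.≟ i ⌋ ∧ ⌊ rel z y Fin.≟ j ⌋) ≡ p i j (rel x y)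

  -- valency k_i, computed at the point x (it does not depend on x)
  valency : Fin n → Fin (suc d) → ℕ
  valency x i = count (λ y → ⌊ rel x y Fin.≟ i ⌋)

module _ {c ℓ} (R : CommutativeRing c ℓ) where
  open CommutativeRing R

  ιℕ : ℕ → Carrier
  ιℕ zero    = 0#
  ιℕ (suc m) = 1# + ιℕ m

  IsField : Set (c ⊔ ℓ)
  IsField = (¬ (1# ≈ 0#)) × (∀ x → ¬ (x ≈ 0#) → Σ Carrier λ y → x * y ≈ 1#)

  CharZero : Set ℓ
  CharZero = ∀ m → ¬ (ιℕ (suc m) ≈ 0#)

  Mat : ℕ → Set c
  Mat n = Fin n → Fin n → Carrier

  ∑ : ∀ {n} → (Fin n → Carrier) → Carrier
  ∑ {zero}  f = 0#
  ∑ {suc n} f = f Fin.zero + ∑ (λ z → f (Fin.suc z))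

  -- W lies in the Bose–Mesner algebra: W = ∑_i w_i A_i
  InBoseMesner : ∀ {n d} → AssocScheme n d → Mat n → Set (c ⊔ ℓ)
  InBoseMesner {n} {d} S W =
    Σ (Fin (suc d) → Carrier) λ w → ∀ x y → W x y ≈ w (AssocScheme.rel S x y)

  -- W has nonzero entries and W (W^(-))^T = n I, W^(-) the entrywise inverse
  TypeII : ∀ {n} → Mat n → Set (c ⊔ ℓ)
  TypeII {n} W =
    (∀ x y → ¬ (W x y ≈ 0#)) ×
    Σ (Mat n) λ Winv →
      (∀ x y → W x y * Winv x y ≈ 1#) ×
      (∀ x y → ∑ (λ z → W x z * Winv y z)
                 ≈ (if ⌊ x Fin.≟ y ⌋ then ιℕ n else 0#))

  HasDistinctEntries : ∀ {n} → ℕ → Mat n → Set (c ⊔ ℓ)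
  HasDistinctEntries {n} m W =
    Σ (Fin m → Carrier) λ v →
      (∀ i j → v i ≈ v j → i ≡ j) ×
      (∀ x y → Σ (Fin m) λ i → W x y ≈ v i) ×
      (∀ i → Σ (Fin n) λ x → Σ (Fin n) λ y → W x y ≈ v i)

  -- D W₁ D' = T W₂ T' with D, D' invertible diagonal and T, T' permutation matrices
  -- ((T W₂ T')_{xy} = W₂ (σ x) (τ y) for suitable permutations σ, τ)
  Equivalent : ∀ {n} → Mat n → Mat n → Set (c ⊔ ℓ)
  Equivalent {n} W₁ W₂ =
    Σ (Fin n → Carrier) λ D → Σ (Fin n → Carrier) λ D′ →
    Σ (Permutation′ n) λ σ → Σ (Permutation′ n) λ τ →
      (∀ x → ¬ (D x ≈ 0#)) × (∀ y → ¬ (D′ y ≈ 0#)) ×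
      (∀ x y → D x * W₁ x y * D′ y ≈ W₂ (σ ⟨$⟩ʳ x) (τ ⟨$⟩ʳ y))

  ScalarMultiple : ∀ {n} → Mat n → Mat n → Set (c ⊔ ℓ)
  ScalarMultiple W W′ = Σ Carrier λ a → ∀ x y → W x y ≈ a * W′ x y

module Submission where

-- Let o be the index of R₁.  The hypothesis p₁₁ⁱ > |X|/2 for
-- i ≠ 0 says that any two points have more than |X|/2 common R₁-neighbours;
-- it also makes k₁ and k₁′ exceed |X|/2, which forces R₁ to be symmetric.
-- Two majorities of X always intersect and a permutation preserves sizes, so
-- for any two points there is a common R₁-neighbour z that stays a common
-- R₁-neighbour after the relabelling by the permutations σ, τ.  Comparing the
-- entries D x · w_o · D′ z = w′_o at such pairs shows that D and D′ are
-- constant, so W′(σx, τy) = κ · W(x, y) for a nonzero scalar κ.  Since W and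
-- W′ have d+1 distinct entries their coefficient vectors are injective, hence
-- the relabelling maps each R_i onto some R_j with the same valency; distinct
-- valencies give j = i, so w′ = κ · w and W = κ⁻¹ · W′.

open import Defs
open import Data.Nat as ℕ using (ℕ; suc; _≤_; _<_; _+_; _*_; z≤n; s≤s)
open import Data.Nat.Properties
  using ( ≤-refl; <-≤-trans; <⇒≱; +-mono-<; m≤n⇒m≤1+n; *-monoʳ-≤
        ; *-distribˡ-+; *-cancelˡ-<; +-identityʳ
        ; +-commutativeSemigroup; +-0-commutativeMonoid; module ≤-Reasoning)
open import Data.Bool using (Bool; true; false; _∧_; _∨_; if_then_else_)
open import Data.Fin as Fin using (Fin; zero; _≟_; punchOut)
open import Data.Fin.Properties using (<⇒notInjective; punchOut-injective)
open import Data.Fin.Permutation using (Permutation′; _⟨$⟩ʳ_)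
open import Data.Product using (Σ; ∃; _×_; _,_; proj₁; proj₂; map₂)
open import Function using (_∘_; _⇔_; mk⇔; Equivalence)
import Function.Properties.Equivalence as ⇔
open import Relation.Nullary using (¬_; yes; no; _×-dec_; contradiction)
open import Relation.Nullary.Decidable using (⌊_⌋; does-⇔; isYes≗does)
open import Relation.Unary using (Decidable)
open import Relation.Binary.PropositionalEquality
  using (_≡_; _≢_; refl; sym; trans; cong; cong₂; subst; subst₂; module ≡-Reasoning)
open import Relation.Binary.Bundles using (Setoid)
open import Algebra.Bundles using (CommutativeRing)
import Algebra.Properties.CommutativeSemigroup as CommSemigroupProps
import Algebra.Properties.CommutativeMonoid.Sum as CommMonoidSum
import Relation.Binary.Reasoning.Setoid as SetoidReasoning

ι : Bool → ℕ
ι b = if b then 1 else 0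

#[_] : ∀ {n} {P : Fin n → Set} → Decidable P → ℕ
#[ P? ] = count (λ z → ⌊ P? z ⌋)

count-cong : ∀ {n} {f g : Fin n → Bool} → (∀ z → f z ≡ g z) → count f ≡ count g
count-cong {ℕ.zero} f≗g = refl
count-cong {suc n} f≗g = cong₂ _+_ (cong ι (f≗g zero)) (count-cong (f≗g ∘ Fin.suc))

count-≤ : ∀ {n} (f : Fin n → Bool) → count f ≤ n
count-≤ {ℕ.zero} f = z≤n
count-≤ {suc n} f with f zero
... | true  = s≤s (count-≤ (f ∘ Fin.suc))
... | false = m≤n⇒m≤1+n (count-≤ (f ∘ Fin.suc))

count-∨-∧ : ∀ {n} (f g : Fin n → Bool) →
            count f + count g ≡ count (λ z → f z ∨ g z) + count (λ z → f z ∧ g z)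
count-∨-∧ {ℕ.zero} f g = refl
count-∨-∧ {suc n} f g = begin
  (ι a + count f′) + (ι b + count g′)
    ≡⟨ interchange (ι a) (count f′) (ι b) (count g′) ⟩
  (ι a + ι b) + (count f′ + count g′)
    ≡⟨ cong₂ _+_ (pointwise a b) (count-∨-∧ f′ g′) ⟩
  (ι (a ∨ b) + ι (a ∧ b)) + (count (λ z → f′ z ∨ g′ z) + count (λ z → f′ z ∧ g′ z))
    ≡⟨ interchange (ι (a ∨ b)) (ι (a ∧ b)) _ _ ⟩
  (ι (a ∨ b) + count (λ z → f′ z ∨ g′ z)) + (ι (a ∧ b) + count (λ z → f′ z ∧ g′ z)) ∎
  where
  open ≡-Reasoning
  open CommSemigroupProps +-commutativeSemigroup using (interchange)
  a b : Bool
  a = f zero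
  b = g zero
  f′ g′ : Fin n → Bool
  f′ = f ∘ Fin.suc
  g′ = g ∘ Fin.suc
  pointwise : ∀ a b → ι a + ι b ≡ ι (a ∨ b) + ι (a ∧ b)
  pointwise false false = refl
  pointwise false true  = refl
  pointwise true  false = refl
  pointwise true  true  = refl

count-perm : ∀ {n} (f : Fin n → Bool) (π : Permutation′ n) →
             count (λ z → f (π ⟨$⟩ʳ z)) ≡ count f
count-perm f π = trans (as-sum (f ∘ (π ⟨$⟩ʳ_)))
                   (trans (sym (sum-permute (ι ∘ f) π)) (sym (as-sum f)))
  where
  open CommMonoidSum +-0-commutativeMonoid using (sum; sum-permute)
  as-sum : ∀ {m} (g : Fin m → Bool) → count g ≡ sum (ι ∘ g)
  as-sum {ℕ.zero} g = refl
  as-sum {suc m} g = cong (ι (g zero) +_) (as-sum (g ∘ Fin.suc))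

#-mono : ∀ {n} {P Q : Fin n → Set} (P? : Decidable P) (Q? : Decidable Q) →
         (∀ z → P z → Q z) → #[ P? ] ≤ #[ Q? ]
#-mono {ℕ.zero} P? Q? P⇒Q = z≤n
#-mono {suc n} P? Q? P⇒Q with P? zero | Q? zero
... | yes p | no ¬q = contradiction (P⇒Q zero p) ¬q
... | yes _ | yes _ = s≤s (#-mono (P? ∘ Fin.suc) (Q? ∘ Fin.suc) (P⇒Q ∘ Fin.suc))
... | no _  | yes _ = m≤n⇒m≤1+n (#-mono (P? ∘ Fin.suc) (Q? ∘ Fin.suc) (P⇒Q ∘ Fin.suc))
... | no _  | no _  = #-mono (P? ∘ Fin.suc) (Q? ∘ Fin.suc) (P⇒Q ∘ Fin.suc)

#-⇔ : ∀ {n} {P Q : Fin n → Set} (P? : Decidable P) (Q? : Decidable Q) →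
      (∀ z → P z ⇔ Q z) → #[ P? ] ≡ #[ Q? ]
#-⇔ P? Q? P⇔Q = count-cong (λ z →
  trans (isYes≗does (P? z)) (trans (does-⇔ (P⇔Q z) (P? z) (Q? z)) (sym (isYes≗does (Q? z)))))

#-× : ∀ {n} {P Q : Fin n → Set} (P? : Decidable P) (Q? : Decidable Q) →
      #[ (λ z → P? z ×-dec Q? z) ] ≡ count (λ z → ⌊ P? z ⌋ ∧ ⌊ Q? z ⌋)
#-× P? Q? = count-cong (λ z → trans (isYes≗does (P? z ×-dec Q? z))
  (sym (cong₂ _∧_ (isYes≗does (P? z)) (isYes≗does (Q? z)))))

#-witness : ∀ {n} {P : Fin n → Set} (P? : Decidable P) → 0 < #[ P? ] → ∃ P
#-witness {ℕ.zero} P? ()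
#-witness {suc n} P? pos with P? zero
... | yes p = zero , p
... | no _  = let (z , p) = #-witness (P? ∘ Fin.suc) pos in Fin.suc z , p

halves-exceed : ∀ {n a b} → n < 2 * a → n < 2 * b → n < a + b
halves-exceed {n} {a} {b} n<2a n<2b = *-cancelˡ-< 2 n (a + b) (begin-strict
  2 * n        ≡⟨ cong (n +_) (+-identityʳ n) ⟩
  n + n        <⟨ +-mono-< n<2a n<2b ⟩
  2 * a + 2 * b ≡⟨ sym (*-distribˡ-+ 2 a b) ⟩
  2 * (a + b)  ∎)
  where open ≤-Reasoning

excess-positive : ∀ {m a} k → m < a + k → a ≤ m → 0 < k
excess-positive ℕ.zero m<a+0 a≤m =
  contradiction (subst (_≤ _) (sym (+-identityʳ _)) a≤m) (<⇒≱ m<a+0)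
excess-positive (suc k) _ _ = s≤s z≤n

majorities-meet : ∀ {n} {P Q : Fin n → Set} (P? : Decidable P) (Q? : Decidable Q) →
                  n < 2 * #[ P? ] → n < 2 * #[ Q? ] → ∃ λ z → P z × Q z
majorities-meet {n} P? Q? big-P big-Q =
  #-witness (λ z → P? z ×-dec Q? z) (subst (0 <_) (sym (#-× P? Q?)) intersection-nonempty)
  where
  f g : Fin n → Bool
  f z = ⌊ P? z ⌋
  g z = ⌊ Q? z ⌋
  -- |P ∪ Q| + |P ∩ Q| = |P| + |Q| > n ≥ |P ∪ Q|
  union+intersection-large : n < count (λ z → f z ∨ g z) + count (λ z → f z ∧ g z)
  union+intersection-large =
    subst (n <_) (count-∨-∧ f g) (halves-exceed {a = count f} {b = count g} big-P big-Q)
  intersection-nonempty : 0 < count (λ z → f z ∧ g z)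
  intersection-nonempty = excess-positive _ union+intersection-large (count-≤ (λ z → f z ∨ g z))

one≢zero : ∀ {d} (1≤d : 1 ≤ d) → one 1≤d ≢ zero
one≢zero (s≤s z≤n) ()

module SchemeFacts {n d} (S : AssocScheme n d) where
  open AssocScheme S

  tr-involutive : ∀ i → tr (tr i) ≡ i
  tr-involutive i with x , y , refl ← nonempty i =
    sym (trans (rel-tr y x) (cong tr (rel-tr x y)))

  transpose : ∀ x z i → rel x z ≡ tr i ⇔ rel z x ≡ i
  transpose x z i = mk⇔ (λ e → trans (rel-tr x z) (trans (cong tr e) (tr-involutive i)))
                        (λ e → trans (rel-tr z x) (cong tr e))

  p-count : ∀ i j x y → #[ (λ z → rel x z ≟ i ×-dec rel z y ≟ j) ] ≡ p i j (rel x y)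
  p-count i j x y = trans (#-× (λ z → rel x z ≟ i) (λ z → rel z y ≟ j)) (p-spec i j x y)

  valency-is-p : ∀ x i → valency x i ≡ p i (tr i) zero
  valency-is-p x i = begin
    valency x i
      ≡⟨ #-⇔ (λ z → rel x z ≟ i) (λ z → rel x z ≟ i ×-dec rel z x ≟ tr i)
             (λ z → mk⇔ (λ e → e , trans (rel-tr x z) (cong tr e)) proj₁) ⟩
    #[ (λ z → rel x z ≟ i ×-dec rel z x ≟ tr i) ]
      ≡⟨ p-count i (tr i) x x ⟩
    p i (tr i) (rel x x)
      ≡⟨ cong (p i (tr i)) (eq⇒rel0 x) ⟩
    p i (tr i) zero ∎
    where open ≡-Reasoning

  valency-independent : ∀ x y i → valency x i ≡ valency y i
  valency-independent x y i = trans (valency-is-p x i) (sym (valency-is-p y i))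

  in-valency : ∀ y i → #[ (λ z → rel z y ≟ i) ] ≡ valency y (tr i)
  in-valency y i = #-⇔ _ _ (λ z → ⇔.sym (transpose y z i))

  -- a relation R_i with k_i, k_{i′} > |X|/2 is symmetric, as both majorities meet
  large-relation-symmetric : ∀ x i → n < 2 * valency x i → n < 2 * valency x (tr i) →
                             tr i ≡ i
  large-relation-symmetric x i big big′ with _ , e , e′ ←
    majorities-meet (λ z → rel x z ≟ i) (λ z → rel x z ≟ tr i) big big′ = trans (sym e′) e

  module LargeR₁ (1≤d : 1 ≤ d)
    (p₁₁-large : ∀ (i : Fin (suc d)) → i ≢ zero → n < 2 * p (one 1≤d) (one 1≤d) i) where

    o : Fin (suc d)
    o = one 1≤d

    x₁ y₁ : Fin n
    x₁ = proj₁ (nonempty o)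
    y₁ = proj₁ (proj₂ (nonempty o))

    path? : Decidable (λ z → rel x₁ z ≡ o × rel z y₁ ≡ o)
    path? z = rel x₁ z ≟ o ×-dec rel z y₁ ≟ o

    paths-large : n < 2 * #[ path? ]
    paths-large = subst (λ k → n < 2 * k)
      (sym (trans (p-count o o x₁ y₁) (cong (p o o) (proj₂ (proj₂ (nonempty o))))))
      (p₁₁-large o (one≢zero 1≤d))

    -- k₁ ≥ p₁₁¹ and k₁′ ≥ p₁₁¹ (count the paths x₁ → z → y₁ by z)
    k₁-large : ∀ x → n < 2 * valency x o
    k₁-large x = <-≤-trans paths-large (*-monoʳ-≤ 2
      (subst (#[ path? ] ≤_) (valency-independent x₁ x o)
             (#-mono path? (λ z → rel x₁ z ≟ o) (λ z → proj₁))))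

    k₁′-large : ∀ x → n < 2 * valency x (tr o)
    k₁′-large x = <-≤-trans paths-large (*-monoʳ-≤ 2
      (subst (#[ path? ] ≤_) (trans (in-valency y₁ o) (valency-independent y₁ x (tr o)))
             (#-mono path? (λ z → rel z y₁ ≟ o) (λ z → proj₂))))

    R₁-symmetric : tr o ≡ o
    R₁-symmetric = large-relation-symmetric x₁ o (k₁-large x₁) (k₁′-large x₁)

    adjacent-sym : ∀ {x z} → rel x z ≡ o → rel z x ≡ o
    adjacent-sym {x} {z} e = Equivalence.to (transpose x z o) (trans e (sym R₁-symmetric))

    common-neighbours-large : ∀ a b → n < 2 * #[ (λ z → rel a z ≟ o ×-dec rel b z ≟ o) ]
    common-neighbours-large a b with a ≟ b
    ... | yes refl = subst (λ k → n < 2 * k)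
            (#-⇔ (λ z → rel a z ≟ o) (λ z → rel a z ≟ o ×-dec rel a z ≟ o)
                 (λ z → mk⇔ (λ e → e , e) proj₁))
            (k₁-large a)
    ... | no a≢b = subst (λ k → n < 2 * k)
            (trans (sym (p-count o o a b))
                   (#-⇔ (λ z → rel a z ≟ o ×-dec rel z b ≟ o)
                        (λ z → rel a z ≟ o ×-dec rel b z ≟ o)
                        (λ z → mk⇔ (map₂ adjacent-sym) (map₂ adjacent-sym))))
            (p₁₁-large (rel a b) (a≢b ∘ rel0⇒eq a b))

    common-neighbour-twice : ∀ (π : Permutation′ n) a b a′ b′ → ∃ λ z →
      (rel a z ≡ o × rel b z ≡ o) × (rel a′ (π ⟨$⟩ʳ z) ≡ o × rel b′ (π ⟨$⟩ʳ z) ≡ o)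
    common-neighbour-twice π a b a′ b′ =
      majorities-meet (λ z → rel a z ≟ o ×-dec rel b z ≟ o)
                      (λ z → rel a′ (π ⟨$⟩ʳ z) ≟ o ×-dec rel b′ (π ⟨$⟩ʳ z) ≟ o)
        (common-neighbours-large a b)
        (subst (λ k → n < 2 * k)
               (sym (count-perm (λ z → ⌊ rel a′ z ≟ o ×-dec rel b′ z ≟ o ⌋) π))
               (common-neighbours-large a′ b′))

-- Pigeonhole: if each of m pairwise distinct values v a occurs among the
-- values of w : Fin m → A, then the values of w are pairwise distinct as well.
values-injective : ∀ {a ℓ} (A : Setoid a ℓ) {m} (v w : Fin m → Setoid.Carrier A) →
  (∀ a b → Setoid._≈_ A (v a) (v b) → a ≡ b) →
  (∀ a → Σ (Fin m) λ k → Setoid._≈_ A (v a) (w k)) →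
  ∀ i j → Setoid._≈_ A (w i) (w j) → i ≡ j
values-injective A {suc d} v w v-injective occurs i j wi≈wj with i ≟ j
... | yes i≡j = i≡j
... | no  i≢j = contradiction (λ {a b} → χ-injective {a} {b}) (<⇒notInjective ≤-refl)
  where
  open Setoid A using (_≈_; reflexive) renaming (sym to ≈-sym; trans to ≈-trans)
  -- an occurrence of v a avoiding the index j (replace j by i if needed)
  avoid-j : ∀ {a} → Σ (Fin (suc d)) (λ k → v a ≈ w k) →
            Σ (Fin (suc d)) λ k → j ≢ k × v a ≈ w k
  avoid-j (k , va≈wk) with k ≟ j
  ... | yes refl = i , (λ j≡i → i≢j (sym j≡i)) , ≈-trans va≈wk (≈-sym wi≈wj)
  ... | no  k≢j  = k , (λ j≡k → k≢j (sym j≡k)) , va≈wk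
  -- dropping j from the range gives an injection Fin (d+1) → Fin d, impossible
  χ : Fin (suc d) → Fin d
  χ a = punchOut (proj₁ (proj₂ (avoid-j (occurs a))))
  χ-injective : ∀ {a b} → χ a ≡ χ b → a ≡ b
  χ-injective {a} {b} χa≡χb with ka , j≢ka , va≈wka ← avoid-j (occurs a)
                               | kb , j≢kb , vb≈wkb ← avoid-j (occurs b) =
    v-injective a b (≈-trans va≈wka (≈-trans (reflexive (cong w ka≡kb)) (≈-sym vb≈wkb)))
    where
    ka≡kb : ka ≡ kb
    ka≡kb = punchOut-injective j≢ka j≢kb χa≡χb

module FieldFacts {c ℓ} (F : CommutativeRing c ℓ) (isField : IsField F) where
  open CommutativeRing F renaming (_*_ to _·_; sym to ≈-sym; trans to ≈-trans)
  open SetoidReasoning setoid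

  inverse : ∀ a → ¬ (a ≈ 0#) → Σ Carrier λ b → a · b ≈ 1#
  inverse = proj₂ isField

  ·-cancelʳ : ∀ {a b u} → ¬ (u ≈ 0#) → a · u ≈ b · u → a ≈ b
  ·-cancelʳ {a} {b} {u} u≉0 au≈bu with u⁻¹ , uu⁻¹≈1 ← inverse u u≉0 = begin
    a              ≈⟨ ≈-sym (*-identityʳ a) ⟩
    a · 1#         ≈⟨ *-congˡ (≈-sym uu⁻¹≈1) ⟩
    a · (u · u⁻¹)  ≈⟨ ≈-sym (*-assoc a u u⁻¹) ⟩
    (a · u) · u⁻¹  ≈⟨ *-congʳ au≈bu ⟩
    (b · u) · u⁻¹  ≈⟨ *-assoc b u u⁻¹ ⟩
    b · (u · u⁻¹)  ≈⟨ *-congˡ uu⁻¹≈1 ⟩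
    b · 1#         ≈⟨ *-identityʳ b ⟩
    b              ∎

  ·-cancelˡ : ∀ {a b u} → ¬ (u ≈ 0#) → u · a ≈ u · b → a ≈ b
  ·-cancelˡ {a} {b} {u} u≉0 ua≈ub =
    ·-cancelʳ u≉0 (≈-trans (*-comm a u) (≈-trans ua≈ub (*-comm u b)))

  ·-nonzero : ∀ {a b} → ¬ (a ≈ 0#) → ¬ (b ≈ 0#) → ¬ (a · b ≈ 0#)
  ·-nonzero {a} a≉0 b≉0 ab≈0 = b≉0 (·-cancelˡ a≉0 (≈-trans ab≈0 (≈-sym (zeroʳ a))))

  divide : ∀ {a b u} (u≉0 : ¬ (u ≈ 0#)) → b ≈ u · a → a ≈ proj₁ (inverse u u≉0) · b
  divide {a} {b} {u} u≉0 b≈ua with u⁻¹ , uu⁻¹≈1 ← inverse u u≉0 = ·-cancelˡ u≉0 (begin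
    u · a          ≈⟨ ≈-sym b≈ua ⟩
    b              ≈⟨ ≈-sym (*-identityˡ b) ⟩
    1# · b         ≈⟨ *-congʳ (≈-sym uu⁻¹≈1) ⟩
    (u · u⁻¹) · b  ≈⟨ *-assoc u u⁻¹ b ⟩
    u · (u⁻¹ · b)  ∎)

module BoseMesnerFacts {c ℓ} (F : CommutativeRing c ℓ) {n d} (S : AssocScheme n d) where
  open CommutativeRing F renaming (trans to ≈-trans; sym to ≈-sym)
  open AssocScheme S using (rel; nonempty)

  coefficients-injective : ∀ {W : Mat F n} {w : Fin (suc d) → Carrier} →
    (∀ x y → W x y ≈ w (rel x y)) →
    HasDistinctEntries F (suc d) W → ∀ i j → w i ≈ w j → i ≡ j
  coefficients-injective {w = w} W≈w (v , v-injective , _ , attained) =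
    values-injective setoid v w v-injective occurs
    where
    occurs : ∀ a → Σ (Fin (suc d)) λ k → v a ≈ w k
    occurs a with x , y , Wxy≈va ← attained a = rel x y , ≈-trans (≈-sym Wxy≈va) (W≈w x y)

  coefficients-nonzero : ∀ {W : Mat F n} {w : Fin (suc d) → Carrier} →
    (∀ x y → W x y ≈ w (rel x y)) →
    (∀ x y → ¬ (W x y ≈ 0#)) → ∀ i → ¬ (w i ≈ 0#)
  coefficients-nonzero W≈w W≉0 i wi≈0 with x , y , refl ← nonempty i =
    W≉0 x y (≈-trans (W≈w x y) wi≈0)

module Rescaling {c ℓ} (F : CommutativeRing c ℓ) (isField : IsField F) where
  open CommutativeRing F
    using (Carrier; _≈_; 0#; setoid; reflexive; *-cong; *-congˡ; *-congʳ; *-commutativeSemigroup)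
    renaming (_*_ to _·_; sym to ≈-sym; trans to ≈-trans)
  open CommSemigroupProps *-commutativeSemigroup using (xy∙z≈xz∙y)
  open FieldFacts F isField
  open SetoidReasoning setoid

  module _ {n d} (S : AssocScheme n d) (1≤d : 1 ≤ d)
    (p₁₁-large : ∀ (i : Fin (suc d)) → i ≢ zero →
                 n < 2 * AssocScheme.p S (one 1≤d) (one 1≤d) i)
    (distinct-valencies : ∀ x (i j : Fin (suc d)) → i ≢ j →
                          AssocScheme.valency S x i ≢ AssocScheme.valency S x j)
    {W W′ : Mat F n} {w w′ : Fin (suc d) → Carrier}
    (W≈w : ∀ x y → W x y ≈ w (AssocScheme.rel S x y))
    (W′≈w′ : ∀ x y → W′ x y ≈ w′ (AssocScheme.rel S x y))
    (w-injective : ∀ i j → w i ≈ w j → i ≡ j)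
    (w′-injective : ∀ i j → w′ i ≈ w′ j → i ≡ j)
    (w≉0 : ∀ i → ¬ (w i ≈ 0#))
    {D D′ : Fin n → Carrier} (D≉0 : ∀ x → ¬ (D x ≈ 0#)) (D′≉0 : ∀ y → ¬ (D′ y ≈ 0#))
    (σ τ : Permutation′ n)
    (DWD′≈W′ : ∀ x y → D x · W x y · D′ y ≈ W′ (σ ⟨$⟩ʳ x) (τ ⟨$⟩ʳ y)) where

    open AssocScheme S using (rel; nonempty; valency)
    open SchemeFacts S using (valency-independent; module LargeR₁)
    open LargeR₁ 1≤d p₁₁-large using (o; adjacent-sym; common-neighbour-twice)

    entrywise : ∀ x z → (D x · w (rel x z)) · D′ z ≈ w′ (rel (σ ⟨$⟩ʳ x) (τ ⟨$⟩ʳ z))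
    entrywise x z = ≈-trans (*-congʳ (*-congˡ (≈-sym (W≈w x z))))
                            (≈-trans (DWD′≈W′ x z) (W′≈w′ _ _))

    doubly-adjacent : ∀ {x z} → rel x z ≡ o → rel (σ ⟨$⟩ʳ x) (τ ⟨$⟩ʳ z) ≡ o →
                      (D x · w o) · D′ z ≈ w′ o
    doubly-adjacent {x} {z} e e′ =
      subst₂ (λ i j → (D x · w i) · D′ z ≈ w′ j) e e′ (entrywise x z)

    -- D is constant: compare x and x′ at a doubly adjacent common neighbour
    D-constant : ∀ x x′ → D x ≈ D x′
    D-constant x x′ with z , (e₁ , e₂) , (e₃ , e₄) ←
      common-neighbour-twice τ x x′ (σ ⟨$⟩ʳ x) (σ ⟨$⟩ʳ x′) =
      ·-cancelʳ (w≉0 o) (·-cancelʳ (D′≉0 z)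
        (≈-trans (doubly-adjacent e₁ e₃) (≈-sym (doubly-adjacent e₂ e₄))))

    -- D′ is constant, by the same argument applied to columns
    D′-constant : ∀ y y′ → D′ y ≈ D′ y′
    D′-constant y y′ with z , (e₁ , e₂) , (e₃ , e₄) ←
      common-neighbour-twice σ y y′ (τ ⟨$⟩ʳ y) (τ ⟨$⟩ʳ y′) =
      ·-cancelˡ (·-nonzero (D≉0 z) (w≉0 o))
        (≈-trans (doubly-adjacent (adjacent-sym e₁) (adjacent-sym e₃))
                 (≈-sym (doubly-adjacent (adjacent-sym e₂) (adjacent-sym e₄))))

    -- a base point of X (nonempty as R₀ is) and the resulting scalar
    ξ : Fin n
    ξ = proj₁ (nonempty zero)

    κ : Carrier
    κ = D ξ · D′ ξ

    κ≉0 : ¬ (κ ≈ 0#)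
    κ≉0 = ·-nonzero (D≉0 ξ) (D′≉0 ξ)

    relabelled : ∀ x y → w′ (rel (σ ⟨$⟩ʳ x) (τ ⟨$⟩ʳ y)) ≈ κ · w (rel x y)
    relabelled x y = begin
      w′ (rel (σ ⟨$⟩ʳ x) (τ ⟨$⟩ʳ y))  ≈⟨ ≈-sym (entrywise x y) ⟩
      (D x · w (rel x y)) · D′ y      ≈⟨ *-cong (*-congʳ (D-constant x ξ)) (D′-constant y ξ) ⟩
      (D ξ · w (rel x y)) · D′ ξ      ≈⟨ xy∙z≈xz∙y (D ξ) (w (rel x y)) (D′ ξ) ⟩
      κ · w (rel x y)                 ∎

    same-relation : ∀ x y z →
      rel x z ≡ rel x y ⇔ rel (σ ⟨$⟩ʳ x) (τ ⟨$⟩ʳ z) ≡ rel (σ ⟨$⟩ʳ x) (τ ⟨$⟩ʳ y)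
    same-relation x y z = mk⇔
      (λ e → w′-injective _ _ (≈-trans (relabelled x z)
               (≈-trans (*-congˡ (reflexive (cong w e))) (≈-sym (relabelled x y)))))
      (λ e → w-injective _ _ (·-cancelˡ κ≉0 (≈-trans (≈-sym (relabelled x z))
               (≈-trans (reflexive (cong w′ e)) (relabelled x y)))))

    -- hence R_i is mapped to a relation of the same valency, which must be R_i
    relation-preserved : ∀ x y → rel (σ ⟨$⟩ʳ x) (τ ⟨$⟩ʳ y) ≡ rel x y
    relation-preserved x y with rel x y ≟ rel (σ ⟨$⟩ʳ x) (τ ⟨$⟩ʳ y)
    ... | yes e = sym e
    ... | no i≢j = contradiction same-valency (distinct-valencies (σ ⟨$⟩ʳ x) _ _ i≢j)
      where
      i j : Fin (suc d)
      i = rel x y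
      j = rel (σ ⟨$⟩ʳ x) (τ ⟨$⟩ʳ y)
      same-valency : valency (σ ⟨$⟩ʳ x) i ≡ valency (σ ⟨$⟩ʳ x) j
      same-valency = trans (valency-independent (σ ⟨$⟩ʳ x) x i)
        (trans (#-⇔ (λ z → rel x z ≟ i) (λ z → rel (σ ⟨$⟩ʳ x) (τ ⟨$⟩ʳ z) ≟ j)
                    (same-relation x y))
               (count-perm (λ z → ⌊ rel (σ ⟨$⟩ʳ x) z ≟ j ⌋) τ))

    proportional : ∀ i → w′ i ≈ κ · w i
    proportional i with x , y , refl ← nonempty i =
      ≈-trans (reflexive (cong w′ (sym (relation-preserved x y)))) (relabelled x y)

    scalar-multiple : ScalarMultiple F W W′
    scalar-multiple = proj₁ (inverse κ κ≉0) , λ x y → divide κ≉0 (begin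
      W′ x y           ≈⟨ W′≈w′ x y ⟩
      w′ (rel x y)     ≈⟨ proportional (rel x y) ⟩
      κ · w (rel x y)  ≈⟨ *-congˡ (≈-sym (W≈w x y)) ⟩
      κ · W x y        ∎)

-- Lemma 5.7: only the entrywise nonvanishing of W is used from the type-II
-- condition.
lemma5p7 : ∀ {c ℓ} (F : CommutativeRing c ℓ) → IsField F → CharZero F →
    (n d : ℕ) (1≤d : 1 ≤ d) (S : AssocScheme n d) (W W′ : Mat F n) →
    InBoseMesner F S W → InBoseMesner F S W′ →
    TypeII F W → TypeII F W′ →
    HasDistinctEntries F (suc d) W → HasDistinctEntries F (suc d) W′ →
    (∀ x (i j : Fin (suc d)) → i ≢ j →
       AssocScheme.valency S x i ≢ AssocScheme.valency S x j) →
    (∀ (i : Fin (suc d)) → i ≢ zero →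
       n < 2 * AssocScheme.p S (one 1≤d) (one 1≤d) i) →
    Equivalent F W W′ →
    ScalarMultiple F W W′
lemma5p7 F isField _ n d 1≤d S W W′ (w , W≈w) (w′ , W′≈w′) (W≉0 , _) _
         distinct distinct′ distinct-valencies p₁₁-large
         (D , D′ , σ , τ , D≉0 , D′≉0 , DWD′≈W′) =
  Rescaling.scalar-multiple F isField S 1≤d p₁₁-large distinct-valencies
    {w = w} {w′ = w′} W≈w W′≈w′
    (coefficients-injective {w = w} W≈w distinct)
    (coefficients-injective {w = w′} W′≈w′ distinct′)
    (coefficients-nonzero {w = w} W≈w W≉0) D≉0 D′≉0 σ τ DWD′≈W′
  where open BoseMesnerFacts F S
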